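{- Let $\eta=(\eta_1,\dots,\eta_r)$ be a composition of $n$ and let $\sigma\in S^\eta$. Then $$|N^+_\sigma[\preceq]|=\operatorname{inv}\big(N(\pi_\eta(\sigma^{ -1}))\big).$$
   Context: Write $[n]=\{1,\dots,n\}$. The block map $\pi_\eta:[n]\to[r]$ sends $i$ to the unique $k$ with $\sum_{l<k}\eta_l<i\le\sum_{l\le k}\eta_l$. For $\tau\in S_n$, $\pi_\eta(\tau)$ denotes the word $\pi_\eta(\tau(1))\pi_\eta(\tau(2))\cdots\pi_\eta(\tau(n))$, which is a rearrangement of $\mathrm{id}=1^{\eta_1}\cdots r^{\eta_r}$. A permutation $\sigma\in S_n$ is $\eta$-admissible if $\sigma(i)<\sigma(j)$ whenever $i<j$ and $\pi_\eta(i)=\pi_\eta(j)$; $S^\eta$ is the set of such permutations. For a word $w=w_1\cdots w_n$ that is a rearrangement of $\mathrm{id}$: $\operatorname{Exc}(w)=\{i:w_i>\mathrm{id}_i\}$, and the non-exceeding subword $N(w)$ is the subword of $w$ formed by the letters in positions $[n]\setminus\operatorname{Exc}(w)$, taken in increasing order of position. For a word $u=u_1\cdots u_m$, $\operatorname{inv}(u)=|\{(i,j):i<j,\ u_i>u_j\}|$. $N^+_\sigma[\preceq]=\{(i,j)\in[n]^2:\sigma(i)<j,\ \sigma^{ -1}(j)<i,\ \pi_\eta(i)\le\pi_\eta(j),\ \pi_\eta(i)\le\pi_\eta(\sigma(i))\}$. -}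

module Defs where

open import Data.Nat using (ℕ; zero; suc; _+_; _∸_; _≤_; _<_; _<?_; _≤?_)
open import Data.Fin using (Fin; toℕ)
open import Data.Fin.Permutation using (Permutation′; _⟨$⟩ʳ_; _⟨$⟩ˡ_)
open import Data.List using (List; []; _∷_; length; filter; allFin; cartesianProduct)
open import Data.Nat.ListAction using (sum)
open import Data.List.Relation.Unary.All using (All)
open import Data.Product using (_×_; _,_)
open import Relation.Nullary using (Dec; yes; no; ¬_; _×-dec_)
open import Relation.Binary.PropositionalEquality using (_≡_)

-- Convention: positions/values are 0-based (Fin n), and blocks are 0-based
-- (block k here corresponds to block k+1 of the paper).  Only the order of
-- block indices matters, so this is harmless.

IsComposition : ℕ → List ℕ → Set
IsComposition n η = All (λ e → 0 < e) η × sum η ≡ n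

blockOf : List ℕ → ℕ → ℕ
blockOf [] i = 0
blockOf (e ∷ es) i with i <? e
... | yes _ = 0
... | no  _ = suc (blockOf es (i ∸ e))

π : ∀ {n} → List ℕ → Fin n → ℕ
π η i = blockOf η (toℕ i)

Admissible : ∀ {n} → List ℕ → Permutation′ n → Set
Admissible {n} η σ = ∀ (i j : Fin n) → toℕ i < toℕ j → π η i ≡ π η j →
                     toℕ (σ ⟨$⟩ʳ i) < toℕ (σ ⟨$⟩ʳ j)

wordπσinv : ∀ {n} → List ℕ → Permutation′ n → Fin n → ℕ
wordπσinv η σ i = π η (σ ⟨$⟩ˡ i)

-- non-exceeding subword N(w) of a word w (given as a function of positions),
-- id_i = π_η(i); excedance positions are those with w_i > id_i
nonExceeding : ∀ {n} → List ℕ → (Fin n → ℕ) → List ℕ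
nonExceeding {n} η w = go (allFin n)
  where
  go : List (Fin n) → List ℕ
  go [] = []
  go (i ∷ is) with π η i <? w i
  ... | yes _ = go is
  ... | no  _ = w i ∷ go is

inv : List ℕ → ℕ
inv [] = 0
inv (x ∷ xs) = length (filter (λ y → y <? x) xs) + inv xs

NPlus : ∀ {n} → List ℕ → Permutation′ n → Fin n × Fin n → Set
NPlus η σ (i , j) =
  (toℕ (σ ⟨$⟩ʳ i) < toℕ j) × (toℕ (σ ⟨$⟩ˡ j) < toℕ i) ×
  (π η i ≤ π η j) × (π η i ≤ π η (σ ⟨$⟩ʳ i))

NPlus? : ∀ {n} (η : List ℕ) (σ : Permutation′ n) (p : Fin n × Fin n) → Dec (NPlus η σ p)
NPlus? η σ (i , j) =
  (toℕ (σ ⟨$⟩ʳ i) <? toℕ j) ×-dec (toℕ (σ ⟨$⟩ˡ j) <? toℕ i) ×-dec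
  (π η i ≤? π η j) ×-dec (π η i ≤? π η (σ ⟨$⟩ʳ i))

cardNPlus : ∀ {n} → List ℕ → Permutation′ n → ℕ
cardNPlus {n} η σ = length (filter (NPlus? η σ) (cartesianProduct (allFin n) (allFin n)))

{-# OPTIONS --safe #-}
module Submission where

open import Defs
open import Level using (0ℓ)
open import Data.Nat using (ℕ; zero; suc; _+_; _≤_; _<_; _<?_; z≤n; s≤s)
open import Data.Nat.Properties
  using (≤-trans; <-≤-trans; ≤-<-trans; <⇒≤; ≤∧≢⇒<; <-asym; ≮⇒≥; ≰⇒>; <⇒≱; ≤⇒≯; ∸-monoˡ-≤; +-0-commutativeMonoid)
open import Data.List using (List; []; _∷_; _++_; length; filter; map; tabulate; allFin; cartesianProduct)
open import Data.List.Properties using (filter-++; filter-accept; filter-reject; length-++)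
open import Data.Fin using (Fin; toℕ) renaming (zero to fzero; suc to fsuc)
open import Data.Fin.Permutation using (Permutation′; _⟨$⟩ʳ_; inverseˡ; inverseʳ)
open import Data.Bool using (true; false; if_then_else_)
open import Data.Product using (_×_; _,_)
open import Function using (_∘_; _⇔_; mk⇔; Equivalence)
open import Relation.Nullary using (Dec; yes; no; does; ¬_; ¬?; _×-dec_; contradiction)
open import Relation.Unary using (Pred; Decidable)
open import Relation.Binary.PropositionalEquality
  using (_≡_; refl; sym; trans; cong; cong₂; subst; module ≡-Reasoning)
open import Algebra.Properties.CommutativeMonoid.Sum +-0-commutativeMonoid
  using (sum-syntax; sum-cong-≗; sum-replicate-zero; ∑-permute)

-- Substituting p = σ(i), a pair (i, j) of N⁺_σ[⪯] becomes a pair of positions p < j of the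
-- word w = π_η(σ⁻¹) with w_j < w_p at which w does not exceed id.  Indeed w_p = π_η(i), so the
-- last condition of N⁺ says that p is non-exceeding; σ⁻¹(j) < i gives w_j ≤ w_p by monotonicity
-- of π_η, strictly because σ is η-admissible while σ(i) < j; conversely w_j < w_p forces
-- σ⁻¹(j) < i, after which π_η(i) ≤ π_η(j) is automatic and j is non-exceeding.  These pairs are
-- exactly the inversions of N(w).

indicator : ∀ {a} {A : Set a} → Dec A → ℕ
indicator A? = if does A? then 1 else 0

indicator-cong : ∀ {a b} {A : Set a} {B : Set b} → A ⇔ B →
  (A? : Dec A) (B? : Dec B) → indicator A? ≡ indicator B?
indicator-cong A⇔B (yes _) (yes _) = refl
indicator-cong A⇔B (yes a) (no ¬b) = contradiction (Equivalence.to A⇔B a) ¬b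
indicator-cong A⇔B (no ¬a) (yes b) = contradiction (Equivalence.from A⇔B b) ¬a
indicator-cong A⇔B (no _) (no _) = refl

module _ {a p} {A : Set a} {P : Pred A p} (P? : Decidable P) where

  length-filter-tabulate : ∀ {k} (f : Fin k → A) →
    length (filter P? (tabulate f)) ≡ ∑[ i < k ] indicator (P? (f i))
  length-filter-tabulate {zero} f = refl
  length-filter-tabulate {suc k} f with does (P? (f fzero))
  ... | true = cong suc (length-filter-tabulate (f ∘ fsuc))
  ... | false = length-filter-tabulate (f ∘ fsuc)

  length-filter-map : ∀ {b} {B : Set b} (g : B → A) xs →
    length (filter P? (map g xs)) ≡ length (filter (P? ∘ g) xs)
  length-filter-map g [] = refl
  length-filter-map g (x ∷ xs) with does (P? (g x))
  ... | true = cong suc (length-filter-map g xs)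
  ... | false = length-filter-map g xs

  length-filter-filter : ∀ {q} {Q : Pred A q} (Q? : Decidable Q) xs →
    length (filter P? (filter Q? xs)) ≡ length (filter (λ x → Q? x ×-dec P? x) xs)
  length-filter-filter Q? [] = refl
  length-filter-filter Q? (x ∷ xs) with does (Q? x)
  ... | false = length-filter-filter Q? xs
  ... | true with does (P? x)
  ...   | true = cong suc (length-filter-filter Q? xs)
  ...   | false = length-filter-filter Q? xs

length-filter-cartesianProduct : ∀ {a b p} {A : Set a} {B : Set b} {P : Pred (A × B) p}
  (P? : Decidable P) {k} (f : Fin k → A) ys →
  length (filter P? (cartesianProduct (tabulate f) ys)) ≡
  ∑[ i < k ] length (filter (λ y → P? (f i , y)) ys)
length-filter-cartesianProduct P? {zero} f ys = refl
length-filter-cartesianProduct {A = A} {B} P? {suc k} f ys = begin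
  length (filter P? (map (f fzero ,_) ys ++ rest))
    ≡⟨ cong length (filter-++ P? (map (f fzero ,_) ys) rest) ⟩
  length (filter P? (map (f fzero ,_) ys) ++ filter P? rest)
    ≡⟨ length-++ (filter P? (map (f fzero ,_) ys)) ⟩
  length (filter P? (map (f fzero ,_) ys)) + length (filter P? rest)
    ≡⟨ cong₂ _+_ (length-filter-map P? (f fzero ,_) ys) (length-filter-cartesianProduct P? (f ∘ fsuc) ys) ⟩
  length (filter (λ y → P? (f fzero , y)) ys) + ∑[ i < k ] length (filter (λ y → P? (f (fsuc i) , y)) ys) ∎
  where
  open ≡-Reasoning
  rest : List (A × B)
  rest = cartesianProduct (tabulate (f ∘ fsuc)) ys

length-filter-allPairs : ∀ {m n p} {P : Pred (Fin m × Fin n) p} (P? : Decidable P) →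
  length (filter P? (cartesianProduct (allFin m) (allFin n))) ≡
  ∑[ i < m ] ∑[ j < n ] indicator (P? (i , j))
length-filter-allPairs {m} {n} P? = begin
  length (filter P? (cartesianProduct (allFin m) (allFin n)))
    ≡⟨ length-filter-cartesianProduct P? (λ i → i) (allFin n) ⟩
  ∑[ i < m ] length (filter (λ j → P? (i , j)) (allFin n))
    ≡⟨ sum-cong-≗ (λ i → length-filter-tabulate (λ j → P? (i , j)) (λ j → j)) ⟩
  ∑[ i < m ] ∑[ j < n ] indicator (P? (i , j)) ∎
  where open ≡-Reasoning

inv-map-filter-tabulate : ∀ {a q} {A : Set a} {Q : Pred A q} (u : A → ℕ) (Q? : Decidable Q)
  {k} (f : Fin k → A) →
  inv (map u (filter Q? (tabulate f))) ≡
  ∑[ i < k ] ∑[ j < k ] indicator ((toℕ i <? toℕ j) ×-dec Q? (f i) ×-dec Q? (f j) ×-dec (u (f j) <? u (f i)))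
inv-map-filter-tabulate u Q? {zero} f = refl
inv-map-filter-tabulate u Q? {suc k} f with does (Q? (f fzero))
... | true = cong₂ _+_ smaller-later (inv-map-filter-tabulate u Q? (f ∘ fsuc))
  where
  open ≡-Reasoning
  x : ℕ
  x = u (f fzero)
  smaller-later : length (filter (_<? x) (map u (filter Q? (tabulate (f ∘ fsuc))))) ≡
                  ∑[ j < k ] indicator (Q? (f (fsuc j)) ×-dec (u (f (fsuc j)) <? x))
  smaller-later = begin
    length (filter (_<? x) (map u (filter Q? (tabulate (f ∘ fsuc)))))
      ≡⟨ length-filter-map (_<? x) u (filter Q? (tabulate (f ∘ fsuc))) ⟩
    length (filter ((_<? x) ∘ u) (filter Q? (tabulate (f ∘ fsuc))))
      ≡⟨ length-filter-filter ((_<? x) ∘ u) Q? (tabulate (f ∘ fsuc)) ⟩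
    length (filter (λ y → Q? y ×-dec (u y <? x)) (tabulate (f ∘ fsuc)))
      ≡⟨ length-filter-tabulate (λ y → Q? y ×-dec (u y <? x)) (f ∘ fsuc) ⟩
    ∑[ j < k ] indicator (Q? (f (fsuc j)) ×-dec (u (f (fsuc j)) <? x)) ∎
... | false = cong₂ _+_ (sym (sum-replicate-zero k)) (inv-map-filter-tabulate u Q? (f ∘ fsuc))

NonExceeding : ∀ {n} → List ℕ → (Fin n → ℕ) → Pred (Fin n) 0ℓ
NonExceeding η w i = ¬ (π η i < w i)

nonExceeding? : ∀ {n} (η : List ℕ) (w : Fin n → ℕ) → Decidable (NonExceeding η w)
nonExceeding? η w i = ¬? (π η i <? w i)

list-induction : ∀ {a p} {A : Set a} {P : List A → Set p} →
  P [] → (∀ x xs → P xs → P (x ∷ xs)) → ∀ xs → P xs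
list-induction base step [] = base
list-induction base step (x ∷ xs) = step x xs (list-induction base step xs)

-- nonExceeding recurses through a where-bound function that is not in scope here; abstracting
-- allFin n exposes it to list-induction, and the type of this step is inferred from that use.
private
  keep-or-drop : ∀ {n} (η : List ℕ) (w : Fin n → ℕ) (i : Fin n) (is : List (Fin n)) → _

nonExceeding≡map-filter : ∀ {n} (η : List ℕ) (w : Fin n → ℕ) →
  nonExceeding η w ≡ map w (filter (nonExceeding? η w) (allFin n))
nonExceeding≡map-filter {n} η w with allFin n
... | is = list-induction refl (keep-or-drop η w) is

keep-or-drop η w i is ih with π η i <? w i
... | yes exceeds = trans ih (cong (map w) (sym (filter-reject (nonExceeding? η w) (contradiction exceeds))))
... | no ¬exceeds = trans (cong (w i ∷_) ih) (cong (map w) (sym (filter-accept (nonExceeding? η w) ¬exceeds)))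

blockOf-mono : ∀ η {a b} → a ≤ b → blockOf η a ≤ blockOf η b
blockOf-mono [] a≤b = z≤n
blockOf-mono (e ∷ es) {a} {b} a≤b with a <? e | b <? e
... | yes _   | _       = z≤n
... | no a≮e  | yes b<e = contradiction (≤-<-trans a≤b b<e) a≮e
... | no _    | no _    = s≤s (blockOf-mono es (∸-monoˡ-≤ e a≤b))

module _ {n : ℕ} (η : List ℕ) where

  π-mono : {i j : Fin n} → toℕ i ≤ toℕ j → π η i ≤ π η j
  π-mono = blockOf-mono η

  π-cancel-< : {i j : Fin n} → π η i < π η j → toℕ i < toℕ j
  π-cancel-< πi<πj = ≰⇒> (λ j≤i → <⇒≱ πi<πj (π-mono j≤i))

  NonExceedingInversion : (Fin n → ℕ) → Fin n → Fin n → Set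
  NonExceedingInversion w p q = toℕ p < toℕ q × NonExceeding η w p × NonExceeding η w q × w q < w p

  nonExceedingInversion? : (w : Fin n → ℕ) (p q : Fin n) → Dec (NonExceedingInversion w p q)
  nonExceedingInversion? w p q =
    (toℕ p <? toℕ q) ×-dec nonExceeding? η w p ×-dec nonExceeding? η w q ×-dec (w q <? w p)

  module _ (σ : Permutation′ n) where

    private
      w : Fin n → ℕ
      w = wordπσinv η σ

    wordπσinv-σ : ∀ i → w (σ ⟨$⟩ʳ i) ≡ π η i
    wordπσinv-σ i = cong (π η) (inverseˡ σ)

    admissible-inversion⇒π< : Admissible η σ → ∀ {a b} →
      toℕ a < toℕ b → toℕ (σ ⟨$⟩ʳ b) < toℕ (σ ⟨$⟩ʳ a) → π η a < π η b
    admissible-inversion⇒π< admissible {a} {b} a<b σb<σa =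
      ≤∧≢⇒< (π-mono (<⇒≤ a<b)) (λ πa≡πb → <-asym (admissible a b a<b πa≡πb) σb<σa)

    NPlus⇔nonExceedingInversion : Admissible η σ → ∀ i j →
      NPlus η σ (i , j) ⇔ NonExceedingInversion w (σ ⟨$⟩ʳ i) j
    NPlus⇔nonExceedingInversion admissible i j = mk⇔ to from
      where
      to : NPlus η σ (i , j) → NonExceedingInversion w (σ ⟨$⟩ʳ i) j
      to (σi<j , σ⁻¹j<i , πi≤πj , πi≤πσi) = σi<j , σi-nonExceeding , j-nonExceeding , wj<wσi
        where
        wj<πi : w j < π η i
        wj<πi = admissible-inversion⇒π< admissible σ⁻¹j<i
                  (subst (λ k → toℕ (σ ⟨$⟩ʳ i) < toℕ k) (sym (inverseʳ σ)) σi<j)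
        wj<wσi : w j < w (σ ⟨$⟩ʳ i)
        wj<wσi = subst (w j <_) (sym (wordπσinv-σ i)) wj<πi
        σi-nonExceeding : NonExceeding η w (σ ⟨$⟩ʳ i)
        σi-nonExceeding exceeds = ≤⇒≯ πi≤πσi (subst (π η (σ ⟨$⟩ʳ i) <_) (wordπσinv-σ i) exceeds)
        j-nonExceeding : NonExceeding η w j
        j-nonExceeding exceeds = <-asym exceeds (<-≤-trans wj<πi πi≤πj)
      from : NonExceedingInversion w (σ ⟨$⟩ʳ i) j → NPlus η σ (i , j)
      from (σi<j , σi-nonExceeding , _ , wj<wσi) =
        σi<j , π-cancel-< wj<πi , ≤-trans πi≤πσi (π-mono (<⇒≤ σi<j)) , πi≤πσi
        where
        wj<πi : w j < π η i
        wj<πi = subst (w j <_) (wordπσinv-σ i) wj<wσi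
        πi≤πσi : π η i ≤ π η (σ ⟨$⟩ʳ i)
        πi≤πσi = subst (_≤ π η (σ ⟨$⟩ʳ i)) (wordπσinv-σ i) (≮⇒≥ σi-nonExceeding)

lemma4p2 : (n : ℕ) (η : List ℕ) → IsComposition n η →
    (σ : Permutation′ n) → Admissible η σ →
    cardNPlus η σ ≡ inv (nonExceeding η (wordπσinv η σ))
lemma4p2 n η _ σ admissible = begin
  cardNPlus η σ
    ≡⟨ length-filter-allPairs (NPlus? η σ) ⟩
  ∑[ i < n ] ∑[ j < n ] indicator (NPlus? η σ (i , j))
    ≡⟨ sum-cong-≗ (λ i → sum-cong-≗ (λ j →
         indicator-cong (NPlus⇔nonExceedingInversion η σ admissible i j)
                        (NPlus? η σ (i , j)) (inversion? (σ ⟨$⟩ʳ i) j))) ⟩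
  ∑[ i < n ] ∑[ j < n ] indicator (inversion? (σ ⟨$⟩ʳ i) j)
    ≡⟨ ∑-permute (λ p → ∑[ j < n ] indicator (inversion? p j)) σ ⟨
  ∑[ p < n ] ∑[ j < n ] indicator (inversion? p j)
    ≡⟨ inv-map-filter-tabulate w (nonExceeding? η w) (λ p → p) ⟨
  inv (map w (filter (nonExceeding? η w) (allFin n)))
    ≡⟨ cong inv (nonExceeding≡map-filter η w) ⟨
  inv (nonExceeding η w) ∎
  where
  open ≡-Reasoning
  w : Fin n → ℕ
  w = wordπσinv η σ
  inversion? : (p q : Fin n) → Dec (NonExceedingInversion η w p q)
  inversion? = nonExceedingInversion? η w
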